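{- Let $r$ and $s$ be positive integers with $r \geq s \geq 3$. If $2s - 2 < r \leq 3s - 3$, then $f(s,r,3) = 6s + 2r - 6$.
   Context: For integers $a\le b$, $[a,b]=\{n\in\mathbb{N} : a\le n\le b\}$. For a finite set $X\subseteq\mathbb{N}$, $\mathrm{diam}(X)=\max(X)-\min(X)$. $f(s,r,3)$ denotes the smallest positive integer $n$ such that for every coloring $\Delta:[1,n]\to\{1,2,3\}$ there exist subsets $S_1,S_2\subseteq[1,n]$ with: (a) $S_1$ and $S_2$ each monochromatic (not necessarily of the same color); (b) $|S_1|=s$, $|S_2|=r$; (c) $\max(S_1)<\min(S_2)$; (d) $\mathrm{diam}(S_1)\le\mathrm{diam}(S_2)$. -}

module Defs where

open import Data.Nat using (ℕ; zero; suc; _+_; _*_; _∸_; _≤_; _<_)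
open import Data.Fin using (Fin)
open import Data.List using (List; []; _∷_; length)
open import Data.List.Relation.Unary.All using (All)
open import Data.List.Relation.Unary.Linked using (Linked)
open import Data.Product using (Σ; _×_; ∃-syntax)
open import Relation.Binary.PropositionalEquality using (_≡_)
open import Relation.Nullary using (¬_)

-- A 3-coloring of [1,n]; values outside [1,n] are irrelevant.
Coloring : Set
Coloring = ℕ → Fin 3

-- Finite sets of naturals are represented by strictly increasing lists
-- (so min = first element, max = last element).
StrictlyIncreasing : List ℕ → Set
StrictlyIncreasing = Linked _<_

-- min and max of a list listed increasingly (default 0 on the empty list;
-- only used on nonempty lists)
minL : List ℕ → ℕ
minL []      = 0
minL (x ∷ _) = x

maxL : List ℕ → ℕ
maxL []           = 0
maxL (x ∷ [])     = x
maxL (_ ∷ y ∷ xs) = maxL (y ∷ xs)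

diam : List ℕ → ℕ
diam xs = maxL xs ∸ minL xs

InInterval : ℕ → List ℕ → Set
InInterval n = All (λ x → 1 ≤ x × x ≤ n)

Monochromatic : Coloring → List ℕ → Set
Monochromatic Δ xs = Σ (Fin 3) λ c → All (λ x → Δ x ≡ c) xs

HasProperty : ℕ → ℕ → ℕ → Set
HasProperty s r n =
  (Δ : Coloring) →
  ∃[ S₁ ] ∃[ S₂ ]
    ( StrictlyIncreasing S₁ × StrictlyIncreasing S₂
    × InInterval n S₁ × InInterval n S₂
    × Monochromatic Δ S₁ × Monochromatic Δ S₂
    × length S₁ ≡ s × length S₂ ≡ r
    × maxL S₁ < minL S₂
    × diam S₁ ≤ diam S₂ )

f3≡ : ℕ → ℕ → ℕ → Set
f3≡ s r N = 1 ≤ N × HasProperty s r N × ((m : ℕ) → 1 ≤ m → m < N → ¬ HasProperty s r m)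

-- Write s = t + 1 and r = q + 1, so that 2t ≤ q < 3t and the claimed value is N = 6t + 2q + 2.
--
-- By pigeonhole [1, 3t + 1] contains a monochromatic S₁ of size t + 1 and diameter
-- at most 3t. The 3t + 2q + 1 points of [3t + 2, N] split into three colour classes. If a class
-- with more than q points has diameter at least diam S₁, a (q + 1)-subset of it with the same
-- extremes is S₂. Otherwise every such class has diameter below 3t, hence at most 3t points, and
-- so two classes L, M are that large. Now let S₁ be the first t + 1 points of the class that
-- starts first, say L: the remaining points of L force diam S₁ ≤ q, so if M starts after S₁, any
-- q + 1 points of M form S₂. If not, L and M, or M and the rest of L, together have more than 3t
-- points inside the span of L or of M, which has at most 3t points.
--
-- Colour [1, N − 1] by consecutive blocks of lengths t, t, t, 3t + 1, q, q with
-- colours 0, 1, 2, 0, 1, 2. Each colour has only t points in [1, 3t], so S₁ reaches beyond 3t and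
-- S₂ starts after 3t; with q + 1 points S₂ then lies in the long 0-block, and S₁, lying below it,
-- has colour 0 as well. They do not both fit into the long block (t + q + 2 > 3t + 1), so S₁
-- starts in [1, t] and jumps over [t + 1, 3t]; hence diam S₁ ≥ 3t, which leaves S₂ too little
-- room after S₁.
module Submission where

open import Defs
open import Data.Nat using (ℕ; zero; suc; _+_; _*_; _∸_; _≤_; _<_; z≤n; s≤s; _≤?_; _<?_)
open import Data.Nat.Properties
open import Data.Nat.Tactic.RingSolver using (solve-∀)
open import Data.Fin using (Fin) renaming (_≟_ to _≟ᶠ_)
open import Data.Fin.Patterns using (0F; 1F; 2F)
open import Data.Fin.Properties using (any?)
open import Data.List using (List; []; _∷_; length; _++_; drop; filter; applyUpTo)
open import Data.List.Properties using (length-drop; length-applyUpTo; length-++)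
open import Data.List.Relation.Unary.All as All using (All; []; _∷_)
import Data.List.Relation.Unary.All.Properties as All
open import Data.List.Relation.Unary.Linked as Linked using ([]; [-]; _∷_)
import Data.List.Relation.Unary.Linked.Properties as Linked
open import Data.Product using (∃; ∃₂; _×_; _,_; proj₁; proj₂)
open import Data.Sum as Sum using (_⊎_; inj₁; inj₂; [_,_]′)
open import Data.Empty using (⊥; ⊥-elim)
open import Function using (_∘_)
open import Relation.Nullary using (Dec; yes; no; ¬_; _×-dec_)
open import Relation.Binary.PropositionalEquality

head-< : ∀ {x xs} → StrictlyIncreasing (x ∷ xs) → All (x <_) xs
head-< [-]         = []
head-< (x<y ∷ ↗ys) = Linked.Linked⇒All <-trans x<y ↗ys

∷-sorted : ∀ {x xs} → All (x <_) xs → StrictlyIncreasing xs → StrictlyIncreasing (x ∷ xs)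
∷-sorted []        _   = [-]
∷-sorted (x<y ∷ _) ↗xs = x<y ∷ ↗xs

All-maxL : ∀ {P : ℕ → Set} {x xs} → All P (x ∷ xs) → P (maxL (x ∷ xs))
All-maxL {xs = []}    (px ∷ []) = px
All-maxL {xs = _ ∷ _} (_ ∷ pxs) = All-maxL pxs

All-minL : ∀ {P : ℕ → Set} {xs} → 0 < length xs → All P xs → P (minL xs)
All-minL {xs = _ ∷ _} _ (px ∷ _) = px

maxL≤ : ∀ {b xs} → All (_≤ b) xs → maxL xs ≤ b
maxL≤ []           = z≤n
maxL≤ xs≤b@(_ ∷ _) = All-maxL xs≤b

≤-maxL : ∀ {x xs} → StrictlyIncreasing (x ∷ xs) → All (_≤ maxL (x ∷ xs)) (x ∷ xs)
≤-maxL [-]         = ≤-refl ∷ []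
≤-maxL (x<y ∷ ↗ys) with ≤-maxL ↗ys
... | y≤m ∷ ys≤m = <⇒≤ (<-≤-trans x<y y≤m) ∷ y≤m ∷ ys≤m

minL-≤ : ∀ {x xs} → StrictlyIncreasing (x ∷ xs) → All (x ≤_) (x ∷ xs)
minL-≤ ↗xs = ≤-refl ∷ All.map <⇒≤ (head-< ↗xs)

maxL<⇒All< : ∀ {x xs p} → StrictlyIncreasing (x ∷ xs) → maxL (x ∷ xs) < p → All (_< p) (x ∷ xs)
maxL<⇒All< ↗xs max<p = All.map (λ z≤max → ≤-<-trans z≤max max<p) (≤-maxL ↗xs)

_∈[_,_] : ℕ → ℕ → ℕ → Set
x ∈[ a , b ] = a ≤ x × x ≤ b

∈-span : ∀ {x xs} → StrictlyIncreasing (x ∷ xs) → All (_∈[ x , maxL (x ∷ xs) ]) (x ∷ xs)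
∈-span ↗xs = All.zip (minL-≤ ↗xs , ≤-maxL ↗xs)

raise-∈ : ∀ {a b c xs} → All (c ≤_) xs → All (_∈[ a , b ]) xs → All (_∈[ c , b ]) xs
raise-∈ c≤xs xs∈ = All.zipWith (λ (c≤x , (_ , x≤b)) → c≤x , x≤b) (c≤xs , xs∈)

tail-∈ : ∀ {a b x xs} → StrictlyIncreasing (x ∷ xs) → All (_∈[ a , b ]) (x ∷ xs) →
  All (_∈[ suc x , b ]) xs
tail-∈ ↗xs xs∈ = raise-∈ (head-< ↗xs) (All.tail xs∈)

private
  shrink-interval : ∀ {a b x} → a ≤ x → x ≤ b → suc (b ∸ x) ≤ suc b ∸ a
  shrink-interval {a} {b} {x} a≤x x≤b = begin
    suc (b ∸ x)  ≡⟨ +-∸-assoc 1 x≤b ⟨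
    suc b ∸ x    ≤⟨ ∸-monoʳ-≤ (suc b) a≤x ⟩
    suc b ∸ a    ∎
    where open ≤-Reasoning

length-≤-interval : ∀ {a b xs} → StrictlyIncreasing xs → All (_∈[ a , b ]) xs →
  length xs ≤ suc b ∸ a
length-≤-interval {xs = []}    _   _                       = z≤n
length-≤-interval {xs = _ ∷ _} ↗xs xs∈@((a≤x , x≤b) ∷ _) =
  ≤-trans (s≤s (length-≤-interval (Linked.tail ↗xs) (tail-∈ ↗xs xs∈))) (shrink-interval a≤x x≤b)

length-≤-block : ∀ {a k xs} → StrictlyIncreasing xs → All (_∈[ suc a , a + k ]) xs → length xs ≤ k
length-≤-block {a} {k} ↗xs xs∈ = ≤-trans (length-≤-interval ↗xs xs∈) (≤-reflexive (m+n∸m≡n a k))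

≢⇒<⊎> : ∀ {x y} → x ≢ y → x < y ⊎ y < x
≢⇒<⊎> {x} {y} x≢y = Sum.map₂ (λ y≤x → ≤∧≢⇒< y≤x (x≢y ∘ sym)) (<-≤-connex x y)

-- The case split uses an eliminator rather than 'with', which would hide the structural descent
-- from the termination checker.
length+length-≤-interval : ∀ {P Q : ℕ → Set} {a b xs ys} → (∀ {z} → P z → Q z → ⊥) →
  StrictlyIncreasing xs → StrictlyIncreasing ys → All P xs → All Q ys →
  All (_∈[ a , b ]) xs → All (_∈[ a , b ]) ys → length xs + length ys ≤ suc b ∸ a
length+length-≤-interval {xs = []} _ _ ↗ys _ _ _ ys∈ = length-≤-interval ↗ys ys∈
length+length-≤-interval {a = a} {b} {xs@(_ ∷ _)} {[]} _ ↗xs _ _ _ xs∈ _ =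
  subst (_≤ suc b ∸ a) (sym (+-identityʳ (length xs))) (length-≤-interval ↗xs xs∈)
length+length-≤-interval {xs = x ∷ xs} {y ∷ ys} P⊥Q ↗xs ↗ys (px ∷ pxs) (qy ∷ qys)
  xs∈@((a≤x , x≤b) ∷ _) ys∈@((a≤y , y≤b) ∷ _) =
  [ (λ x<y → ≤-trans
      (s≤s (length+length-≤-interval P⊥Q (Linked.tail ↗xs) ↗ys pxs (qy ∷ qys)
        (tail-∈ ↗xs xs∈) (raise-∈ (Linked.Linked⇒All <-trans x<y ↗ys) ys∈)))
      (shrink-interval a≤x x≤b))
  , (λ y<x → ≤-trans (≤-reflexive (+-suc (length (x ∷ xs)) (length ys))) (≤-trans
      (s≤s (length+length-≤-interval P⊥Q ↗xs (Linked.tail ↗ys) (px ∷ pxs) qys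
        (raise-∈ (Linked.Linked⇒All <-trans y<x ↗xs) xs∈) (tail-∈ ↗ys ys∈)))
      (shrink-interval a≤y y≤b)))
  ]′ (≢⇒<⊎> λ { refl → P⊥Q px qy })

suc-maxL∸minL : ∀ {x xs} → StrictlyIncreasing (x ∷ xs) →
  suc (maxL (x ∷ xs)) ∸ x ≡ suc (diam (x ∷ xs))
suc-maxL∸minL ↗xs = +-∸-assoc 1 (All-maxL (minL-≤ ↗xs))

length≤1+diam : ∀ {xs} → StrictlyIncreasing xs → length xs ≤ suc (diam xs)
length≤1+diam {[]}    _   = z≤n
length≤1+diam {_ ∷ _} ↗xs =
  ≤-trans (length-≤-interval ↗xs (∈-span ↗xs)) (≤-reflexive (suc-maxL∸minL ↗xs))

diam-≤ : ∀ {a b xs} → All (_∈[ a , b ]) xs → diam xs ≤ b ∸ a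
diam-≤ []                    = z≤n
diam-≤ xs∈@((a≤x , _) ∷ _) = ∸-mono (proj₂ (All-maxL xs∈)) a≤x

drop-sorted : ∀ d {xs} → StrictlyIncreasing xs → StrictlyIncreasing (drop d xs)
drop-sorted zero            ↗xs = ↗xs
drop-sorted (suc d) {[]}    _   = []
drop-sorted (suc d) {_ ∷ _} ↗xs = drop-sorted d (Linked.tail ↗xs)

maxL-∷-drop : ∀ z d xs → d < length xs → maxL (z ∷ drop d xs) ≡ maxL (z ∷ xs)
maxL-∷-drop z zero    xs           _         = refl
maxL-∷-drop z (suc d) (_ ∷ y ∷ ys) (s≤s d<) = maxL-∷-drop z d (y ∷ ys) d<
maxL-∷-drop z (suc d) (_ ∷ [])     (s≤s ())

sublist-with-same-diam : ∀ {k xs} → StrictlyIncreasing xs → 2 ≤ k → k ≤ length xs →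
  ∃ λ ys → StrictlyIncreasing ys × length ys ≡ k × diam ys ≡ diam xs
         × (∀ {P : ℕ → Set} → All P xs → All P ys)
sublist-with-same-diam {suc k} {x ∷ xs} ↗xs (s≤s 1≤k) (s≤s k≤|xs|) =
  x ∷ drop d xs ,
  ∷-sorted (All.drop⁺ d (head-< ↗xs)) (drop-sorted d (Linked.tail ↗xs)) ,
  cong suc (trans (length-drop d xs) (m∸[m∸n]≡n k≤|xs|)) ,
  cong (_∸ x) (maxL-∷-drop x d xs (∸-monoʳ-< {o = 0} 1≤k k≤|xs|)) ,
  λ { (px ∷ pxs) → px ∷ All.drop⁺ d pxs }
  where
  d : ℕ
  d = length xs ∸ k

split-at : ∀ k (xs : List ℕ) → k ≤ length xs → ∃₂ λ ys zs → xs ≡ ys ++ zs × length ys ≡ k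
split-at zero    xs       _         = [] , xs , refl , refl
split-at (suc k) (x ∷ xs) (s≤s k≤) with split-at k xs k≤
... | ys , zs , refl , refl = x ∷ ys , zs , refl , refl

sorted-++⁻ : ∀ {x} xs {ys} → StrictlyIncreasing (x ∷ xs ++ ys) →
  StrictlyIncreasing (x ∷ xs) × StrictlyIncreasing ys × All (maxL (x ∷ xs) <_) ys
sorted-++⁻ []       ↗ys          = [-] , Linked.tail ↗ys , head-< ↗ys
sorted-++⁻ (_ ∷ xs) (x<y ∷ ↗xys) with sorted-++⁻ xs ↗xys
... | ↗xs , ↗ys , max<ys = x<y ∷ ↗xs , ↗ys , max<ys

-- Colour classes and pigeonholes

range : ℕ → ℕ → List ℕ
range a n = applyUpTo (a +_) n

range-sorted : ∀ a n → StrictlyIncreasing (range a n)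
range-sorted a n = Linked.applyUpTo⁺₂ (a +_) n (λ i → +-monoʳ-< a (n<1+n i))

range-∈ : ∀ {a b} n → a + n ≤ suc b → All (_∈[ a , b ]) (range a n)
range-∈ {a} n a+n≤1+b = All.applyUpTo⁺₁ (a +_) n
  (λ {i} i<n → m≤m+n a i , ≤-pred (≤-trans (+-monoʳ-< a i<n) a+n≤1+b))

colourClass : Coloring → Fin 3 → List ℕ → List ℕ
colourClass Δ c = filter (λ x → Δ x ≟ᶠ c)

colourClass-partition : ∀ Δ xs →
  length (colourClass Δ 0F xs) + length (colourClass Δ 1F xs) + length (colourClass Δ 2F xs) ≡ length xs
colourClass-partition Δ []       = refl
colourClass-partition Δ (x ∷ xs) with Δ x | colourClass-partition Δ xs
... | 0F | eq = cong suc eq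
... | 1F | eq = trans (cong (_+ length (colourClass Δ 2F xs)) (+-suc _ _)) (cong suc eq)
... | 2F | eq = trans (+-suc _ _) (cong suc eq)

pigeonhole : ∀ k (f : Fin 3 → ℕ) → 3 * k < f 0F + f 1F + f 2F → ∃ λ c → k < f c
pigeonhole k f 3k<Σf with any? (λ c → k <? f c)
... | yes large = large
... | no  none  = ⊥-elim (<⇒≱ 3k<Σf (begin
  f 0F + f 1F + f 2F  ≤⟨ +-mono-≤ (+-mono-≤ (small 0F) (small 1F)) (small 2F) ⟩
  k + k + k           ≡⟨ k+k+k≡3k k ⟩
  3 * k               ∎))
  where
  open ≤-Reasoning
  small : ∀ c → f c ≤ k
  small c = ≮⇒≥ (λ k<fc → none (c , k<fc))
  k+k+k≡3k : ∀ k → k + k + k ≡ 3 * k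
  k+k+k≡3k = solve-∀

pigeonhole₂ : ∀ m q (f : Fin 3 → ℕ) → q ≤ m → (∀ c → q < f c → f c ≤ m) →
  m + q + q < f 0F + f 1F + f 2F → ∃₂ λ X Y → X ≢ Y × q < f X × q < f Y
pigeonhole₂ m q f q≤m large≤m m+q+q<Σf = go (q <? f 0F) (q <? f 1F) (q <? f 2F)
  where
  ≤m : ∀ c → f c ≤ m
  ≤m c with q <? f c
  ... | yes q<fc = large≤m c q<fc
  ... | no  q≮fc = ≤-trans (≮⇒≥ q≮fc) q≤m

  too-small : ∀ {a b c} → f 0F ≤ a → f 1F ≤ b → f 2F ≤ c → a + b + c ≡ m + q + q → ⊥
  too-small f₀≤ f₁≤ f₂≤ eq =
    <⇒≱ m+q+q<Σf (≤-trans (+-mono-≤ (+-mono-≤ f₀≤ f₁≤) f₂≤) (≤-reflexive eq))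

  q+q+m≡m+q+q : ∀ m q → q + q + m ≡ m + q + q
  q+q+m≡m+q+q = solve-∀

  go : Dec (q < f 0F) → Dec (q < f 1F) → Dec (q < f 2F) → ∃₂ λ X Y → X ≢ Y × q < f X × q < f Y
  go _          (yes q<f₁) (yes q<f₂) = 1F , 2F , (λ ()) , q<f₁ , q<f₂
  go (yes q<f₀) (yes q<f₁) (no _)     = 0F , 1F , (λ ()) , q<f₀ , q<f₁
  go (yes q<f₀) (no _)     (yes q<f₂) = 0F , 2F , (λ ()) , q<f₀ , q<f₂
  go _          (no q≮f₁)  (no q≮f₂)  = ⊥-elim (too-small (≤m 0F) (≮⇒≥ q≮f₁) (≮⇒≥ q≮f₂) refl)
  go (no q≮f₀)  (yes _)    (no q≮f₂)  =
    ⊥-elim (too-small (≮⇒≥ q≮f₀) (≤m 1F) (≮⇒≥ q≮f₂) (cong (_+ q) (+-comm q m)))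
  go (no q≮f₀)  (no q≮f₁)  (yes _)    =
    ⊥-elim (too-small (≮⇒≥ q≮f₀) (≮⇒≥ q≮f₁) (≤m 2F) (q+q+m≡m+q+q m q))

-- Linear arithmetic is done by certificates: the hypotheses are added up with +-mono-≤ and the
-- resulting identity is checked by the ring solver.

absurd-sum : ∀ {m n} k → m ≤ n → n + suc k ≡ m → ⊥
absurd-sum {n = n} k m≤n eq = m+1+n≰m n (≤-trans (≤-reflexive eq) m≤n)

≤-from-sum : ∀ {p q a b} k → a ≤ b → p + b + k ≡ q + a → p ≤ q
≤-from-sum {p} {q} {a} {b} k a≤b eq = +-cancelʳ-≤ b p q (begin
  p + b      ≤⟨ m≤m+n (p + b) k ⟩
  p + b + k  ≡⟨ eq ⟩
  q + a      ≤⟨ +-monoʳ-≤ q a≤b ⟩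
  q + b      ∎)
  where open ≤-Reasoning

<3*⇒1≤ : ∀ {m t} → m < 3 * t → 1 ≤ t
<3*⇒1≤ {t = suc _} _ = s≤s z≤n

record ColourSet (Δ : Coloring) (n : ℕ) (c : Fin 3) (S : List ℕ) : Set where
  field
    sorted : StrictlyIncreasing S
    inside : InInterval n S
    colour : All (λ x → Δ x ≡ c) S

colourClass-set : ∀ Δ c {a b} n → 1 ≤ a → a + n ≤ suc b →
  ColourSet Δ b c (colourClass Δ c (range a n))
colourClass-set Δ c {a} n 1≤a a+n≤1+b = record
  { sorted = Linked.filter⁺ (λ x → Δ x ≟ᶠ c) <-trans (range-sorted a n)
  ; inside = All.filter⁺ (λ x → Δ x ≟ᶠ c)
               (All.map (λ (a≤x , x≤b) → ≤-trans 1≤a a≤x , x≤b) (range-∈ n a+n≤1+b))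
  ; colour = All.all-filter (λ x → Δ x ≟ᶠ c) (range a n)
  }

ColourSet-widen : ∀ {Δ m n c S} → m ≤ n → ColourSet Δ m c S → ColourSet Δ n c S
ColourSet-widen m≤n set = record
  { sorted = sorted set
  ; inside = All.map (λ (1≤x , x≤m) → 1≤x , ≤-trans x≤m m≤n) (inside set)
  ; colour = colour set
  }
  where open ColourSet

ColourSet-shrink : ∀ {Δ n c k S} → ColourSet Δ n c S → 2 ≤ k → k ≤ length S →
  ∃ λ S′ → ColourSet Δ n c S′ × length S′ ≡ k × diam S′ ≡ diam S
         × (∀ {P : ℕ → Set} → All P S → All P S′)
ColourSet-shrink set 2≤k k≤|S| with sublist-with-same-diam (ColourSet.sorted set) 2≤k k≤|S|
... | S′ , ↗S′ , |S′| , same-diam , sub =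
  S′ , record { sorted = ↗S′ ; inside = sub (inside set) ; colour = sub (colour set) } , |S′| , same-diam , sub
  where open ColourSet

record GoodPair (Δ : Coloring) (s r n : ℕ) : Set where
  field
    S₁ S₂ : List ℕ
    c₁ c₂ : Fin 3
    set₁  : ColourSet Δ n c₁ S₁
    set₂  : ColourSet Δ n c₂ S₂
    size₁ : length S₁ ≡ s
    size₂ : length S₂ ≡ r
    gap   : maxL S₁ < minL S₂
    diam≤ : diam S₁ ≤ diam S₂

GoodPair-widen : ∀ {Δ s r m n} → m ≤ n → GoodPair Δ s r m → GoodPair Δ s r n
GoodPair-widen m≤n pair = record
  { set₁ = ColourSet-widen m≤n set₁ ; set₂ = ColourSet-widen m≤n set₂
  ; size₁ = size₁ ; size₂ = size₂ ; gap = gap ; diam≤ = diam≤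
  }
  where open GoodPair pair

hasProperty : ∀ {s r n} → (∀ Δ → GoodPair Δ s r n) → HasProperty s r n
hasProperty good Δ = let open GoodPair (good Δ); open ColourSet in
  S₁ , S₂ , sorted set₁ , sorted set₂ , inside set₁ , inside set₂ ,
  (c₁ , colour set₁) , (c₂ , colour set₂) , size₁ , size₂ , gap , diam≤

goodPair : ∀ {s r n} → HasProperty s r n → ∀ Δ → GoodPair Δ s r n
goodPair has Δ with has Δ
... | _ , _ , ↗S₁ , ↗S₂ , S₁∈ , S₂∈ , (_ , S₁-colour) , (_ , S₂-colour) ,
      size₁ , size₂ , gap , diam≤ = record
    { set₁ = record { sorted = ↗S₁ ; inside = S₁∈ ; colour = S₁-colour }
    ; set₂ = record { sorted = ↗S₂ ; inside = S₂∈ ; colour = S₂-colour }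
    ; size₁ = size₁ ; size₂ = size₂ ; gap = gap ; diam≤ = diam≤
    }

-- The upper bound

module _ {Δ : Coloring} {n t q : ℕ} (2t≤q : 2 * t ≤ q) where

  private
    t≤q : t ≤ q
    t≤q = ≤-trans (m≤m+n t (t + 0)) 2t≤q

  two-classes : ∀ {X Y L M} → X ≢ Y → ColourSet Δ n X L → ColourSet Δ n Y M →
    q < length L → q < length M → diam L < 3 * t → diam M < 3 * t → minL L < minL M →
    GoodPair Δ (suc t) (suc q) n
  two-classes {X} {Y} {x₁ ∷ L′} {y₁ ∷ M′}
              X≢Y L-set M-set (s≤s q≤|L′|) q<|M| diamL<3t diamM<3t x₁<y₁
    with split-at t L′ (≤-trans t≤q q≤|L′|)
  ... | P , Qs , refl , |P|≡t =
    [ good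
    , (λ y₁≤a → ⊥-elim ([ nested y₁≤a , crossing y₁≤a ]′ (≤-<-connex yl xl)))
    ]′ (<-≤-connex a y₁)
    where
    open ColourSet
    L M S₁ : List ℕ
    L  = x₁ ∷ P ++ Qs
    M  = y₁ ∷ M′
    S₁ = x₁ ∷ P
    a xl yl : ℕ
    a  = maxL S₁
    xl = maxL L
    yl = maxL M

    ↗L : StrictlyIncreasing L
    ↗L = sorted L-set
    ↗M : StrictlyIncreasing M
    ↗M = sorted M-set
    ↗S₁ : StrictlyIncreasing S₁
    ↗S₁ = proj₁ (sorted-++⁻ P ↗L)
    ↗Qs : StrictlyIncreasing Qs
    ↗Qs = proj₁ (proj₂ (sorted-++⁻ P ↗L))
    a<Qs : All (a <_) Qs
    a<Qs = proj₂ (proj₂ (sorted-++⁻ P ↗L))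
    Qs≤xl : All (_≤ xl) Qs
    Qs≤xl = All.++⁻ʳ S₁ (≤-maxL ↗L)

    X≢Y-at : ∀ {z} → Δ z ≡ X → Δ z ≡ Y → ⊥
    X≢Y-at Δz≡X Δz≡Y = X≢Y (trans (sym Δz≡X) Δz≡Y)

    S₁-set : ColourSet Δ n X S₁
    S₁-set = record
      { sorted = ↗S₁ ; inside = All.++⁻ˡ S₁ (inside L-set) ; colour = All.++⁻ˡ S₁ (colour L-set) }

    q≤t+|Qs| : q ≤ t + length Qs
    q≤t+|Qs| = ≤-trans q≤|L′| (≤-reflexive (trans (length-++ P) (cong (_+ length Qs) |P|≡t)))

    t≤xl∸a : t ≤ xl ∸ a
    t≤xl∸a = ≤-trans (≤-from-sum 0 (+-mono-≤ 2t≤q q≤t+|Qs|) (sum≡ t q (length Qs)))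
                     (length-≤-interval ↗Qs (All.zip (a<Qs , Qs≤xl)))
      where
      sum≡ : ∀ t q k → t + (q + (t + k)) + 0 ≡ k + (2 * t + q)
      sum≡ = solve-∀

    diamS₁≤q : diam S₁ ≤ q
    diamS₁≤q = m≤n+o⇒m∸n≤o a x₁ (≤-from-sum 1 (+-mono-≤ a+t<x₁+3t 2t≤q) (sum≡ a x₁ t q))
      where
      open ≤-Reasoning
      a+t<x₁+3t : suc (a + t) ≤ x₁ + 3 * t
      a+t<x₁+3t = begin
        suc (a + t)         ≤⟨ s≤s (+-monoʳ-≤ a t≤xl∸a) ⟩
        suc (a + (xl ∸ a))  ≡⟨ cong suc (m+[n∸m]≡n (All-maxL (All.++⁻ˡ S₁ (≤-maxL ↗L)))) ⟩
        suc xl              ≤⟨ s≤s (m≤n+m∸n xl x₁) ⟩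
        suc (x₁ + diam L)   ≡⟨ +-suc x₁ (diam L) ⟨
        x₁ + suc (diam L)   ≤⟨ +-monoʳ-≤ x₁ diamL<3t ⟩
        x₁ + 3 * t          ∎
      sum≡ : ∀ a x₁ t q → a + (x₁ + 3 * t + q) + 1 ≡ x₁ + q + (suc (a + t) + 2 * t)
      sum≡ = solve-∀

    good : a < y₁ → GoodPair Δ (suc t) (suc q) n
    good a<y₁ with ColourSet-shrink M-set (s≤s (≤-trans (<3*⇒1≤ diamL<3t) t≤q)) q<|M|
    ... | S₂ , S₂-set , |S₂| , diamS₂≡diamM , sub = record
      { set₁ = S₁-set ; set₂ = S₂-set ; size₁ = cong suc |P|≡t ; size₂ = |S₂|
      ; gap = All-minL (≤-trans (s≤s z≤n) (≤-reflexive (sym |S₂|)))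
                       (sub (Linked.Linked⇒All <-trans a<y₁ ↗M))
      ; diam≤ = ≤-trans diamS₁≤q (≤-trans q≤diamM (≤-reflexive (sym diamS₂≡diamM)))
      }
      where
      q≤diamM : q ≤ diam M
      q≤diamM = ≤-pred (≤-trans q<|M| (length≤1+diam ↗M))

    nested : y₁ ≤ a → yl ≤ xl → ⊥
    nested _ yl≤xl = absurd-sum (suc t)
      (+-mono-≤ (≤-trans (+-mono-≤ (s≤s q≤|L′|) q<|M|) |L|+|M|≤3t) (+-mono-≤ 2t≤q 2t≤q))
      (sum≡ t q)
      where
      M∈ : All (_∈[ x₁ , xl ]) M
      M∈ = All.zip ( All.map (≤-trans (<⇒≤ x₁<y₁)) (minL-≤ ↗M)
                   , All.map (λ z≤yl → ≤-trans z≤yl yl≤xl) (≤-maxL ↗M))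
      |L|+|M|≤3t : length L + length M ≤ 3 * t
      |L|+|M|≤3t = ≤-trans
        (length+length-≤-interval X≢Y-at ↗L ↗M (colour L-set) (colour M-set) (∈-span ↗L) M∈)
        (≤-trans (≤-reflexive (suc-maxL∸minL ↗L)) diamL<3t)
      sum≡ : ∀ t q → 3 * t + (q + q) + suc (suc t) ≡ suc q + suc q + (2 * t + 2 * t)
      sum≡ = solve-∀

    crossing : y₁ ≤ a → xl < yl → ⊥
    crossing y₁≤a xl<yl = absurd-sum 0
      (+-mono-≤ (+-mono-≤ (+-mono-≤ (+-mono-≤ q≤t+|Qs| q<|M|) |Qs|+|M|≤3t) 2t≤q) 2t≤q)
      (sum≡ t q (length Qs) (length M))
      where
      Qs∈ : All (_∈[ y₁ , yl ]) Qs
      Qs∈ = All.zipWith (λ (a<z , z≤xl) → ≤-trans y₁≤a (<⇒≤ a<z) , ≤-trans z≤xl (<⇒≤ xl<yl))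
                        (a<Qs , Qs≤xl)
      |Qs|+|M|≤3t : length Qs + length M ≤ 3 * t
      |Qs|+|M|≤3t = ≤-trans
        (length+length-≤-interval X≢Y-at ↗Qs ↗M (All.++⁻ʳ S₁ (colour L-set)) (colour M-set)
          Qs∈ (∈-span ↗M))
        (≤-trans (≤-reflexive (suc-maxL∸minL ↗M)) diamM<3t)
      sum≡ : ∀ t q k m → t + k + m + 3 * t + q + q + 1 ≡ q + suc q + (k + m) + 2 * t + 2 * t
      sum≡ = solve-∀

module _ {t q : ℕ} (2t≤q : 2 * t ≤ q) (q<3t : q < 3 * t) (Δ : Coloring) where

  private
    N : ℕ
    N = 6 * t + 2 * q + 2

    left right : List ℕ
    left  = range 1 (suc (3 * t))
    right = range (suc (suc (3 * t))) (3 * t + 2 * q + 1)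

    right-ends : suc (suc (3 * t)) + (3 * t + 2 * q + 1) ≤ suc N
    right-ends = ≤-reflexive (ends≡ t q)
      where
      ends≡ : ∀ t q → suc (suc (3 * t)) + (3 * t + 2 * q + 1) ≡ suc (6 * t + 2 * q + 2)
      ends≡ = solve-∀

    1≤q : 1 ≤ q
    1≤q = ≤-trans (<3*⇒1≤ q<3t) (≤-trans (m≤m+n t (t + 0)) 2t≤q)

    3t+1≤N : suc (3 * t) ≤ N
    3t+1≤N = ≤-trans (m≤m+n (suc (3 * t)) (3 * t + 2 * q + 1)) (≤-reflexive (N≡ t q))
      where
      N≡ : ∀ t q → suc (3 * t) + (3 * t + 2 * q + 1) ≡ 6 * t + 2 * q + 2
      N≡ = solve-∀

    class : Fin 3 → List ℕ
    class X = colourClass Δ X right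

    class-set : ∀ X → ColourSet Δ N X (class X)
    class-set X = colourClass-set Δ X (3 * t + 2 * q + 1) (s≤s z≤n) right-ends

    3t+1<class : ∀ X → All (suc (3 * t) <_) (class X)
    3t+1<class X = All.filter⁺ (λ x → Δ x ≟ᶠ X) (All.map proj₁ (range-∈ (3 * t + 2 * q + 1) right-ends))

    class-sizes : 3 * t + q + q < length (class 0F) + length (class 1F) + length (class 2F)
    class-sizes = ≤-reflexive (trans (sizes≡ t q)
      (sym (trans (colourClass-partition Δ right) (length-applyUpTo _ (3 * t + 2 * q + 1)))))
      where
      sizes≡ : ∀ t q → suc (3 * t + q + q) ≡ 3 * t + 2 * q + 1
      sizes≡ = solve-∀

    from-narrow-classes : (∀ X → q < length (class X) → diam (class X) < 3 * t) →
      GoodPair Δ (suc t) (suc q) N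
    from-narrow-classes narrow
      with pigeonhole₂ (3 * t) q (λ X → length (class X)) (<⇒≤ q<3t)
             (λ X q<|X| → ≤-trans (length≤1+diam (ColourSet.sorted (class-set X))) (narrow X q<|X|))
             class-sizes
    ... | X , Y , X≢Y , q<|X| , q<|Y| =
      [ two-classes 2t≤q X≢Y (class-set X) (class-set Y) q<|X| q<|Y| (narrow X q<|X|) (narrow Y q<|Y|)
      , two-classes 2t≤q (X≢Y ∘ sym) (class-set Y) (class-set X) q<|Y| q<|X| (narrow Y q<|Y|) (narrow X q<|X|)
      ]′ (≢⇒<⊎> minL≢)
      where
      minL≢ : minL (class X) ≢ minL (class Y)
      minL≢ eq = X≢Y (trans (sym (All-minL (≤-trans (s≤s z≤n) q<|X|) (ColourSet.colour (class-set X))))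
                     (trans (cong Δ eq) (All-minL (≤-trans (s≤s z≤n) q<|Y|) (ColourSet.colour (class-set Y)))))

    from-left-set : ∀ {c S₁} → ColourSet Δ (suc (3 * t)) c S₁ → length S₁ ≡ suc t →
      GoodPair Δ (suc t) (suc q) N
    from-left-set {S₁ = S₁} S₁-set |S₁|
      with any? (λ X → (q <? length (class X)) ×-dec (diam S₁ ≤? diam (class X)))
    ... | yes (X , q<|X| , diamS₁≤) with ColourSet-shrink (class-set X) (s≤s 1≤q) q<|X|
    ...   | S₂ , S₂-set , |S₂| , diamS₂≡ , sub = record
      { set₁ = ColourSet-widen 3t+1≤N S₁-set ; set₂ = S₂-set ; size₁ = |S₁| ; size₂ = |S₂|
      ; gap = ≤-<-trans (maxL≤ (All.map proj₂ (ColourSet.inside S₁-set)))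
                (All-minL (≤-trans (s≤s z≤n) (≤-reflexive (sym |S₂|))) (sub (3t+1<class X)))
      ; diam≤ = ≤-trans diamS₁≤ (≤-reflexive (sym diamS₂≡))
      }
    from-left-set S₁-set |S₁| | no none = from-narrow-classes λ X q<|X| →
      <-≤-trans (≰⇒> (λ diamS₁≤ → none (X , q<|X| , diamS₁≤))) (diam-≤ (ColourSet.inside S₁-set))

  upper-bound : GoodPair Δ (suc t) (suc q) N
  upper-bound with pigeonhole t (λ c → length (colourClass Δ c left))
    (≤-reflexive (sym (trans (colourClass-partition Δ left) (length-applyUpTo (1 +_) (suc (3 * t))))))
  ... | c , t<|c|
    with ColourSet-shrink (colourClass-set Δ c (suc (3 * t)) ≤-refl ≤-refl) (s≤s (<3*⇒1≤ q<3t)) t<|c|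
  ...   | S₁ , S₁-set , |S₁| , _ = from-left-set S₁-set |S₁|

-- The lower bound

extremal : ℕ → ℕ → Coloring
extremal t q x with x ≤? t | x ≤? 2 * t | x ≤? 3 * t | x ≤? 6 * t + 1 | x ≤? 6 * t + 1 + q
... | yes _ | _     | _     | _     | _     = 0F
... | no _  | yes _ | _     | _     | _     = 1F
... | no _  | no _  | yes _ | _     | _     = 2F
... | no _  | no _  | no _  | yes _ | _     = 0F
... | no _  | no _  | no _  | no _  | yes _ = 1F
... | no _  | no _  | no _  | no _  | no _  = 2F

module _ {t q x : ℕ} where

  extremal≡0 : extremal t q x ≡ 0F → x ≤ t ⊎ x ∈[ suc (3 * t) , 6 * t + 1 ]
  extremal≡0 with x ≤? t | x ≤? 2 * t | x ≤? 3 * t | x ≤? 6 * t + 1 | x ≤? 6 * t + 1 + q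
  ... | yes x≤t | _     | _       | _      | _     = λ _ → inj₁ x≤t
  ... | no _    | yes _ | _       | _      | _     = λ ()
  ... | no _    | no _  | yes _   | _      | _     = λ ()
  ... | no _    | no _  | no x≰3t | yes x≤ | _     = λ _ → inj₂ (≰⇒> x≰3t , x≤)
  ... | no _    | no _  | no _    | no _   | yes _ = λ ()
  ... | no _    | no _  | no _    | no _   | no _  = λ ()

  extremal≡1 : extremal t q x ≡ 1F → x ∈[ suc t , 2 * t ] ⊎ x ∈[ suc (6 * t + 1) , 6 * t + 1 + q ]
  extremal≡1 with x ≤? t | x ≤? 2 * t | x ≤? 3 * t | x ≤? 6 * t + 1 | x ≤? 6 * t + 1 + q
  ... | yes _  | _      | _     | _     | _      = λ ()
  ... | no x≰t | yes x≤ | _     | _     | _      = λ _ → inj₁ (≰⇒> x≰t , x≤)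
  ... | no _   | no _   | yes _ | _     | _      = λ ()
  ... | no _   | no _   | no _  | yes _ | _      = λ ()
  ... | no _   | no _   | no _  | no x≰ | yes x≤ = λ _ → inj₂ (≰⇒> x≰ , x≤)
  ... | no _   | no _   | no _  | no _  | no _   = λ ()

  extremal≡2 : extremal t q x ≡ 2F → x ∈[ suc (2 * t) , 3 * t ] ⊎ suc (6 * t + 1 + q) ≤ x
  extremal≡2 with x ≤? t | x ≤? 2 * t | x ≤? 3 * t | x ≤? 6 * t + 1 | x ≤? 6 * t + 1 + q
  ... | yes _ | _     | _      | _     | _     = λ ()
  ... | no _  | yes _ | _      | _     | _     = λ ()
  ... | no _  | no x≰ | yes x≤ | _     | _     = λ _ → inj₁ (≰⇒> x≰ , x≤)
  ... | no _  | no _  | no _   | yes _ | _     = λ ()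
  ... | no _  | no _  | no _   | no _  | yes _ = λ ()
  ... | no _  | no _  | no _   | no _  | no x≰ = λ _ → inj₂ (≰⇒> x≰)

module _ {t q : ℕ} where

  private
    Γ : Coloring
    Γ = extremal t q

    N′ : ℕ
    N′ = 6 * t + 2 * q + 1

    2t≤3t : 2 * t ≤ 3 * t
    2t≤3t = *-monoˡ-≤ t {2} {3} (s≤s (s≤s z≤n))

    3t≤6t+1 : 3 * t ≤ 6 * t + 1
    3t≤6t+1 = ≤-trans (*-monoˡ-≤ t {3} {6} (s≤s (s≤s (s≤s z≤n)))) (m≤m+n (6 * t) 1)

  prefix-small : ∀ {c S} → StrictlyIncreasing S → All (λ x → Γ x ≡ c) S → All (_∈[ 1 , 3 * t ]) S →
    length S ≤ t
  prefix-small {0F} ↗S S-colour S∈ = length-≤-block {0} ↗S (All.zipWith block (S-colour , S∈))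
    where
    block : ∀ {x} → Γ x ≡ 0F × x ∈[ 1 , 3 * t ] → x ∈[ 1 , t ]
    block (Γx≡0 , 1≤x , x≤3t) with extremal≡0 Γx≡0
    ... | inj₁ x≤t        = 1≤x , x≤t
    ... | inj₂ (3t<x , _) = ⊥-elim (<⇒≱ 3t<x x≤3t)
  prefix-small {1F} ↗S S-colour S∈ = length-≤-block {t} ↗S (All.zipWith block (S-colour , S∈))
    where
    block : ∀ {x} → Γ x ≡ 1F × x ∈[ 1 , 3 * t ] → x ∈[ suc t , t + t ]
    block (Γx≡1 , _ , x≤3t) with extremal≡1 Γx≡1
    ... | inj₁ (t<x , x≤2t) = t<x , ≤-trans x≤2t (≤-reflexive (cong (t +_) (+-identityʳ t)))
    ... | inj₂ (6t+1<x , _) = ⊥-elim (<⇒≱ 6t+1<x (≤-trans x≤3t 3t≤6t+1))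
  prefix-small {2F} ↗S S-colour S∈ = length-≤-block {2 * t} ↗S (All.zipWith block (S-colour , S∈))
    where
    3t≡2t+t : ∀ t → 3 * t ≡ 2 * t + t
    3t≡2t+t = solve-∀
    block : ∀ {x} → Γ x ≡ 2F × x ∈[ 1 , 3 * t ] → x ∈[ suc (2 * t) , 2 * t + t ]
    block (Γx≡2 , _ , x≤3t) with extremal≡2 Γx≡2
    ... | inj₁ (2t<x , x≤3t) = 2t<x , ≤-trans x≤3t (≤-reflexive (3t≡2t+t t))
    ... | inj₂ 6t+1+q<x      = ⊥-elim (<⇒≱ 6t+1+q<x (≤-trans x≤3t (≤-trans 3t≤6t+1 (m≤m+n _ q))))

  private
    prefix-⊥ : ∀ {n c S} → ColourSet Γ n c S → length S ≡ suc t → All (_≤ 3 * t) S → ⊥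
    prefix-⊥ set |S| S≤3t = 1+n≰n (≤-trans (≤-reflexive (sym |S|))
      (prefix-small (sorted set) (colour set)
        (All.zipWith (λ ((1≤x , _) , x≤3t) → 1≤x , x≤3t) (inside set , S≤3t))))
      where open ColourSet

  low-set-colour₀ : ∀ {n c S} → ColourSet Γ n c S → length S ≡ suc t → All (_≤ 6 * t + 1) S → c ≡ 0F
  low-set-colour₀ {c = 0F} _ _ _ = refl
  low-set-colour₀ {c = 1F} set |S| S≤6t+1 =
    ⊥-elim (prefix-⊥ set |S| (All.zipWith early (ColourSet.colour set , S≤6t+1)))
    where
    early : ∀ {x} → Γ x ≡ 1F × x ≤ 6 * t + 1 → x ≤ 3 * t
    early (Γx≡1 , x≤6t+1) with extremal≡1 Γx≡1
    ... | inj₁ (_ , x≤2t)   = ≤-trans x≤2t 2t≤3t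
    ... | inj₂ (6t+1<x , _) = ⊥-elim (<⇒≱ 6t+1<x x≤6t+1)
  low-set-colour₀ {c = 2F} set |S| S≤6t+1 =
    ⊥-elim (prefix-⊥ set |S| (All.zipWith early (ColourSet.colour set , S≤6t+1)))
    where
    early : ∀ {x} → Γ x ≡ 2F × x ≤ 6 * t + 1 → x ≤ 3 * t
    early (Γx≡2 , x≤6t+1) with extremal≡2 Γx≡2
    ... | inj₁ (_ , x≤3t) = x≤3t
    ... | inj₂ 6t+1+q<x   = ⊥-elim (<⇒≱ 6t+1+q<x (≤-trans x≤6t+1 (m≤m+n _ q)))

  high-set-colour₀ : ∀ {c S} → ColourSet Γ N′ c S → length S ≡ suc q → All (3 * t <_) S →
    c ≡ 0F × All (_≤ 6 * t + 1) S
  high-set-colour₀ {0F} set _ 3t<S = refl , All.zipWith late (ColourSet.colour set , 3t<S)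
    where
    late : ∀ {x} → Γ x ≡ 0F × 3 * t < x → x ≤ 6 * t + 1
    late (Γx≡0 , 3t<x) with extremal≡0 Γx≡0
    ... | inj₁ x≤t          = ⊥-elim (<⇒≱ 3t<x (≤-trans x≤t (m≤m+n t (t + (t + 0)))))
    ... | inj₂ (_ , x≤6t+1) = x≤6t+1
  high-set-colour₀ {1F} set |S| 3t<S = ⊥-elim (1+n≰n (≤-trans (≤-reflexive (sym |S|))
    (length-≤-block (ColourSet.sorted set) (All.zipWith late (ColourSet.colour set , 3t<S)))))
    where
    late : ∀ {x} → Γ x ≡ 1F × 3 * t < x → x ∈[ suc (6 * t + 1) , 6 * t + 1 + q ]
    late (Γx≡1 , 3t<x) with extremal≡1 Γx≡1
    ... | inj₁ (_ , x≤2t) = ⊥-elim (<⇒≱ 3t<x (≤-trans x≤2t 2t≤3t))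
    ... | inj₂ x∈         = x∈
  high-set-colour₀ {2F} set |S| 3t<S = ⊥-elim (1+n≰n (≤-trans (≤-reflexive (sym |S|))
    (length-≤-block (ColourSet.sorted set)
      (All.zipWith late (ColourSet.colour set , All.zip (ColourSet.inside set , 3t<S))))))
    where
    N′≡ : ∀ t q → 6 * t + 2 * q + 1 ≡ 6 * t + 1 + q + q
    N′≡ = solve-∀
    late : ∀ {x} → Γ x ≡ 2F × x ∈[ 1 , N′ ] × 3 * t < x →
      x ∈[ suc (6 * t + 1 + q) , 6 * t + 1 + q + q ]
    late (Γx≡2 , (_ , x≤N′) , 3t<x) with extremal≡2 Γx≡2
    ... | inj₁ (_ , x≤3t) = ⊥-elim (<⇒≱ 3t<x x≤3t)
    ... | inj₂ 6t+1+q<x   = 6t+1+q<x , ≤-trans x≤N′ (≤-reflexive (N′≡ t q))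

  module _ (2t≤q : 2 * t ≤ q) {y ys p ps}
           (S₁-set : ColourSet Γ N′ 0F (y ∷ ys)) (↗S₂ : StrictlyIncreasing (p ∷ ps))
           (|ys| : length ys ≡ t) (|ps| : length ps ≡ q) (S₂≤6t+1 : All (_≤ 6 * t + 1) (p ∷ ps))
           (3t<p : 3 * t < p) (yq<p : maxL (y ∷ ys) < p) (D₁≤D₂ : diam (y ∷ ys) ≤ diam (p ∷ ps))
           where

    private
      S₁ S₂ : List ℕ
      S₁ = y ∷ ys
      S₂ = p ∷ ps
      yq : ℕ
      yq = maxL S₁
      ↗S₁ : StrictlyIncreasing S₁
      ↗S₁ = ColourSet.sorted S₁-set

      both-high-⊥ : 3 * t < y → ⊥
      both-high-⊥ 3t<y = absurd-sum 0
        (+-mono-≤ (m≤o∸n⇒m+n≤o (suc t + suc q) 3t≤6t+1 (≤-trans (≤-reflexive sizes) |S₁|+|S₂|≤))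
                  2t≤q)
        (sum≡ t q)
        where
        S₁∈ : All (_∈[ suc (3 * t) , 6 * t + 1 ]) S₁
        S₁∈ = All.map (λ (y≤x , x<p) → <-≤-trans 3t<y y≤x , ≤-trans (<⇒≤ x<p) (All.head S₂≤6t+1))
                (All.zip (minL-≤ ↗S₁ , maxL<⇒All< ↗S₁ yq<p))
        S₂∈ : All (_∈[ suc (3 * t) , 6 * t + 1 ]) S₂
        S₂∈ = All.zip (All.map (<-≤-trans 3t<p) (minL-≤ ↗S₂) , S₂≤6t+1)
        |S₁|+|S₂|≤ : length S₁ + length S₂ ≤ 6 * t + 1 ∸ 3 * t
        |S₁|+|S₂|≤ = length+length-≤-interval (λ x<p p≤x → <⇒≱ x<p p≤x) ↗S₁ ↗S₂
          (maxL<⇒All< ↗S₁ yq<p) (minL-≤ ↗S₂) S₁∈ S₂∈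
        sizes : suc t + suc q ≡ length S₁ + length S₂
        sizes = sym (cong₂ _+_ (cong suc |ys|) (cong suc |ps|))
        sum≡ : ∀ t q → 6 * t + 1 + q + 1 ≡ suc t + suc q + 3 * t + 2 * t
        sum≡ = solve-∀

      straddling-⊥ : y ≤ t → 3 * t < yq → ⊥
      straddling-⊥ y≤t 3t<yq = absurd-sum 0
        (+-mono-≤ (+-mono-≤ (+-mono-≤ (+-mono-≤ 3t<1+D₁ 3t<1+D₁) D₁+yq<6t+2) y+D₁≤yq) 1≤y)
        (sum≡ t D₁ yq y)
        where
        open ≤-Reasoning
        D₁ D₂ : ℕ
        D₁ = diam S₁
        D₂ = diam S₂
        H : List ℕ
        H = range (suc t) (2 * t)
        H∈ : All (_∈[ suc t , 3 * t ]) H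
        H∈ = range-∈ (2 * t) (≤-reflexive (ends≡ t))
          where
          ends≡ : ∀ t → suc t + 2 * t ≡ suc (3 * t)
          ends≡ = solve-∀
        H∈-span : All (_∈[ y , yq ]) H
        H∈-span = All.map (λ (t<x , x≤3t) → ≤-trans y≤t (<⇒≤ t<x) , ≤-trans x≤3t (<⇒≤ 3t<yq)) H∈
        colour₀∉H : ∀ {x} → Γ x ≡ 0F → x ∈[ suc t , 3 * t ] → ⊥
        colour₀∉H Γx≡0 (t<x , x≤3t) =
          [ (λ x≤t → <⇒≱ t<x x≤t) , (λ (3t<x , _) → <⇒≱ 3t<x x≤3t) ]′ (extremal≡0 Γx≡0)
        3t<1+D₁ : suc t + 2 * t ≤ suc D₁
        3t<1+D₁ = begin
          suc t + 2 * t         ≡⟨ cong₂ _+_ (cong suc (sym |ys|)) (sym (length-applyUpTo _ (2 * t))) ⟩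
          length S₁ + length H  ≤⟨ length+length-≤-interval colour₀∉H ↗S₁ (range-sorted (suc t) (2 * t))
                                     (ColourSet.colour S₁-set) H∈ (∈-span ↗S₁) H∈-span ⟩
          suc yq ∸ y            ≡⟨ suc-maxL∸minL ↗S₁ ⟩
          suc D₁                ∎
        D₁+yq<6t+2 : D₁ + suc yq ≤ 6 * t + 1
        D₁+yq<6t+2 = begin
          D₁ + suc yq  ≤⟨ +-mono-≤ D₁≤D₂ yq<p ⟩
          D₂ + p       ≡⟨ m∸n+n≡m (All-maxL (minL-≤ ↗S₂)) ⟩
          maxL S₂      ≤⟨ All-maxL S₂≤6t+1 ⟩
          6 * t + 1    ∎
        y+D₁≤yq : y + D₁ ≤ yq
        y+D₁≤yq = ≤-reflexive (m+[n∸m]≡n (All-maxL (minL-≤ ↗S₁)))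
        1≤y : 1 ≤ y
        1≤y = proj₁ (All.head (ColourSet.inside S₁-set))
        sum≡ : ∀ t d m y → suc d + suc d + (6 * t + 1) + m + y + 1
                         ≡ suc t + 2 * t + (suc t + 2 * t) + (d + suc m) + (y + d) + 1
        sum≡ = solve-∀

    colour₀-pair-⊥ : ⊥
    colour₀-pair-⊥ with y ≤? 3 * t
    ... | no  y≰3t = both-high-⊥ (≰⇒> y≰3t)
    ... | yes y≤3t with extremal≡0 (All.head (ColourSet.colour S₁-set)) | yq ≤? 3 * t
    ...   | inj₂ (3t<y , _) | _         = <⇒≱ 3t<y y≤3t
    ...   | inj₁ _          | yes yq≤3t =
      prefix-⊥ S₁-set (cong suc |ys|) (All.map (λ x≤yq → ≤-trans x≤yq yq≤3t) (≤-maxL ↗S₁))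
    ...   | inj₁ y≤t        | no  yq≰3t = straddling-⊥ y≤t (≰⇒> yq≰3t)

  no-good-pair : 2 * t ≤ q → ¬ GoodPair Γ (suc t) (suc q) N′
  no-good-pair _ record { S₁ = [] ; size₁ = () }
  no-good-pair _ record { S₂ = [] ; size₂ = () }
  no-good-pair 2t≤q record { S₁ = y ∷ ys ; S₂ = p ∷ ps
                           ; set₁ = set₁@record { sorted = ↗S₁ } ; set₂ = set₂@record { sorted = ↗S₂ }
                           ; size₁ = size₁ ; size₂ = size₂ ; gap = gap ; diam≤ = diam≤ }
    with p ≤? 3 * t
  ... | yes p≤3t =
    prefix-⊥ set₁ size₁ (All.map (λ x<p → ≤-trans (<⇒≤ x<p) p≤3t) (maxL<⇒All< ↗S₁ gap))
  ... | no p≰3t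
    with high-set-colour₀ set₂ size₂ (All.map (<-≤-trans (≰⇒> p≰3t)) (minL-≤ ↗S₂))
  ...   | refl , S₂≤6t+1
    with low-set-colour₀ set₁ size₁
           (All.map (λ x<p → ≤-trans (<⇒≤ x<p) (All.head S₂≤6t+1)) (maxL<⇒All< ↗S₁ gap))
  ...     | refl = colour₀-pair-⊥ 2t≤q set₁ ↗S₂ (suc-injective size₁) (suc-injective size₂)
                     S₂≤6t+1 (≰⇒> p≰3t) gap diam≤

lower-bound : ∀ {t q m} → 2 * t ≤ q → m < 6 * t + 2 * q + 2 → ¬ HasProperty (suc t) (suc q) m
lower-bound {t} {q} {m} 2t≤q m<N has =
  no-good-pair 2t≤q (GoodPair-widen m≤N′ (goodPair has (extremal t q)))
  where
  m≤N′ : m ≤ 6 * t + 2 * q + 1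
  m≤N′ = ≤-pred (≤-trans m<N (≤-reflexive (+-suc (6 * t + 2 * q) 1)))

k*[1+n]∸k≡k*n : ∀ k n → k * suc n ∸ k ≡ k * n
k*[1+n]∸k≡k*n k n = trans (cong (_∸ k) (*-suc k n)) (m+n∸m≡n k (k * n))

6[1+t]+2[1+q]∸6≡ : ∀ t q → 6 * suc t + 2 * suc q ∸ 6 ≡ 6 * t + 2 * q + 2
6[1+t]+2[1+q]∸6≡ t q = trans (cong (_∸ 6) (split≡ t q)) (m+n∸m≡n 6 (6 * t + 2 * q + 2))
  where
  split≡ : ∀ t q → 6 * suc t + 2 * suc q ≡ 6 + (6 * t + 2 * q + 2)
  split≡ = solve-∀

theorem4p5 : (s r : ℕ) → 3 ≤ s → s ≤ r → 2 * s ∸ 2 < r → r ≤ 3 * s ∸ 3 →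
    f3≡ s r (6 * s + 2 * r ∸ 6)
theorem4p5 zero    _       _ _ 0<r r≤0 = ⊥-elim (<⇒≱ 0<r r≤0)
theorem4p5 (suc t) zero    _ _ ()  _
theorem4p5 (suc t) (suc q) _ _ 2s∸2<r r≤3s∸3 rewrite 6[1+t]+2[1+q]∸6≡ t q =
  ≤-trans (s≤s z≤n) (m≤n+m 2 (6 * t + 2 * q)) ,
  hasProperty (upper-bound 2t≤q q<3t) ,
  λ m _ m<N → lower-bound 2t≤q m<N
  where
  2t≤q : 2 * t ≤ q
  2t≤q = ≤-pred (subst (_< suc q) (k*[1+n]∸k≡k*n 2 t) 2s∸2<r)
  q<3t : q < 3 * t
  q<3t = subst (suc q ≤_) (k*[1+n]∸k≡k*n 3 t) r≤3s∸3
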